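{- Up to equivalence there are exactly four complete extended systems: $\mathbf{GS1p}$, $\mathbf{Pp}$, $\mathbf{Np}$ and $\mathbf{Mp}$. That is, each of these is a complete extended system, and every complete extended system is equivalent to one of them.
   Context: Formulas are built from literals (propositional variables $P$ and their complements $\bar P$) using $\wedge$ and $\vee$. Negation satisfies $\neg P=\bar P$ and is extended by De Morgan's laws. A sequent is a nonempty finite multiset of formulas. A comma denotes multiset union, and $\Gamma,\Delta,\Sigma$ denote possibly empty multisets. A formula is valid if it evaluates to $1$ under every $0/1$-assignment. Rules: - Axiom: infer $P,\neg P$ from no premises. - $(\&)$: from $\Gamma,A$ and $\Gamma,B$ infer $\Gamma,A\wedge B$. - $(\otimes)$: from $\Delta,A$ and $\Sigma,B$ infer $\Delta,\Sigma,A\wedge B$. - $(\wedge)$: from $\Gamma,\Delta,A$ and $\Gamma,\Sigma,B$ infer $\Gamma,\Delta,\Sigma,A\wedge B$. - $(\oplus)$: consists of both $(\oplus_1)$ and $(\oplus_2)$, where $(\oplus_i)$ infers $\Gamma,A_1\vee A_2$ from $\Gamma,A_i$. - $(\mathrm{par})$: from $\Gamma,A,B$ infer $\Gamma,A\vee B$. - $(\mathsf W)$: from $\Gamma$ infer $\Gamma,A$. - $(\mathsf C)$: from $\Gamma,A,A$ infer $\Gamma,A$. An extended system is the axiom together with any subset of $\{(\otimes),(\wedge),(\&),(\oplus),(\mathrm{par}),(\mathsf C),(\mathsf W)\}$. The named systems are: - $\mathbf{GS1p}$ = axiom + $(\&),(\oplus),(\mathsf W),(\mathsf C)$; - $\mathbf{Pp}$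 = axiom + $(\otimes),(\oplus),(\mathsf C)$; - $\mathbf{Np}$ = axiom + $(\&),(\mathrm{par}),(\mathsf W)$; - $\mathbf{Mp}$ = axiom + $(\wedge),(\oplus),(\mathrm{par})$. A rule is derivable in $S$ if, for every instance of it, the conclusion is derivable in $S$ from its premises used as extra leaves. $S$ contains $T$ if every rule of $T$ is derivable in $S$. Two systems are equivalent if each contains the other. A system is complete if every valid formula is derivable in it. -}

module Defs where

open import Data.Nat using (ℕ)
open import Data.Bool using (Bool; true; false; not) renaming (_∧_ to _&&_; _∨_ to _||_)
open import Data.List using (List; []; _∷_; _++_; [_])
open import Data.List.Relation.Unary.All using (All)
open import Data.List.Membership.Propositional using (_∈_)
open import Data.List.Relation.Binary.Permutation.Propositional using (_↭_)
open import Data.Product using (_×_)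
open import Data.Sum using (_⊎_)
open import Data.Empty using (⊥)
open import Relation.Binary.PropositionalEquality using (_≡_)

infixr 6 _∧_
infixr 5 _∨_

-- Formulas: literals (variable P = pos P, complement P̄ = neg P), ∧, ∨.
data Formula : Set where
  pos neg : ℕ → Formula
  _∧_ _∨_ : Formula → Formula → Formula

¬f : Formula → Formula
¬f (pos p) = neg p
¬f (neg p) = pos p
¬f (A ∧ B) = ¬f A ∨ ¬f B
¬f (A ∨ B) = ¬f A ∧ ¬f B

eval : (ℕ → Bool) → Formula → Bool
eval v (pos p) = v p
eval v (neg p) = not (v p)
eval v (A ∧ B) = eval v A && eval v B
eval v (A ∨ B) = eval v A || eval v B

Valid : Formula → Set
Valid A = ∀ (v : ℕ → Bool) → eval v A ≡ true

-- Sequents: finite multisets of formulas, represented as lists taken up to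
-- permutation (derivability below is closed under permutation).
Sequent : Set
Sequent = List Formula

data Rule : Set where
  ⊗r ∧r &r ⊕r parr Cr Wr : Rule

data Instance : Rule → List Sequent → Sequent → Set where
  &-inst : ∀ Γ A B →
    Instance &r ((Γ ++ [ A ]) ∷ (Γ ++ [ B ]) ∷ []) (Γ ++ [ A ∧ B ])
  ⊗-inst : ∀ Δ Σ A B →
    Instance ⊗r ((Δ ++ [ A ]) ∷ (Σ ++ [ B ]) ∷ []) (Δ ++ Σ ++ [ A ∧ B ])
  ∧-inst : ∀ Γ Δ Σ A B →
    Instance ∧r ((Γ ++ Δ ++ [ A ]) ∷ (Γ ++ Σ ++ [ B ]) ∷ []) (Γ ++ Δ ++ Σ ++ [ A ∧ B ])
  ⊕₁-inst : ∀ Γ A₁ A₂ →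
    Instance ⊕r ((Γ ++ [ A₁ ]) ∷ []) (Γ ++ [ A₁ ∨ A₂ ])
  ⊕₂-inst : ∀ Γ A₁ A₂ →
    Instance ⊕r ((Γ ++ [ A₂ ]) ∷ []) (Γ ++ [ A₁ ∨ A₂ ])
  par-inst : ∀ Γ A B →
    Instance parr ((Γ ++ A ∷ B ∷ []) ∷ []) (Γ ++ [ A ∨ B ])
  -- the premise Γ must be a sequent, i.e. nonempty: Γ = C ∷ Γ'
  W-inst : ∀ C Γ A →
    Instance Wr ((C ∷ Γ) ∷ []) (C ∷ Γ ++ [ A ])
  C-inst : ∀ Γ A →
    Instance Cr ((Γ ++ A ∷ A ∷ []) ∷ []) (Γ ++ [ A ])

-- An extended system: the axiom together with a subset of the seven rules.
System : Set
System = Rule → Bool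

data Deriv (S : System) (H : Sequent → Set) : Sequent → Set where
  axiom : ∀ p → Deriv S H (pos p ∷ ¬f (pos p) ∷ [])
  leaf  : ∀ {Γ} → H Γ → Deriv S H Γ
  exch  : ∀ {Γ Δ} → Γ ↭ Δ → Deriv S H Γ → Deriv S H Δ
  apply : ∀ {r ps c} → S r ≡ true → Instance r ps c →
          All (Deriv S H) ps → Deriv S H c

Derivable : System → Sequent → Set
Derivable S Γ = Deriv S (λ _ → ⊥) Γ

RuleDerivable : System → Rule → Set
RuleDerivable S r = ∀ ps c → Instance r ps c → Deriv S (λ Γ → Γ ∈ ps) c

Contains : System → System → Set
Contains S T = ∀ r → T r ≡ true → RuleDerivable S r

Equivalent : System → System → Set
Equivalent S T = Contains S T × Contains T S

Complete : System → Set
Complete S = ∀ A → Valid A → Derivable S [ A ]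

GS1p Pp Np Mp : System
GS1p &r = true
GS1p ⊕r = true
GS1p Wr = true
GS1p Cr = true
GS1p _  = false
Pp ⊗r = true
Pp ⊕r = true
Pp Cr = true
Pp _  = false
Np &r   = true
Np parr = true
Np Wr   = true
Np _    = false
Mp ∧r   = true
Mp ⊕r   = true
Mp parr = true
Mp _    = false

-- Mp is complete: every valid sequent has a sub-multiset derivable in Mp, by induction on its
-- formulas, where the mixed rule ∧ lets the derivations chosen for the two conjuncts share their
-- common context. GS1p, Pp and Np derive every rule of Mp, so they are complete as well.
-- Conversely, each missing combination of rules is refuted by an invariant of derivations that
-- fails on one valid formula: a complete system needs a disjunction and a conjunction rule, par
-- unless it has C, ⊕ unless it has W, ⊗ or ∧ when it has C but not W, & or ∧ when it has W but
-- not C, and ∧ when it has neither. Splitting on C and W, a complete system therefore derives the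
-- rules of GS1p, Pp, Np or Mp respectively, and that system in turn derives all of its rules.

module Submission where

open import Defs
open import Data.Bool using (Bool; true; false; not; if_then_else_) renaming (_∧_ to _&&_; _∨_ to _||_)
open import Data.Bool.Properties using (∧-comm; ∧-zeroʳ; ∧-conicalˡ; ∧-conicalʳ; ∨-inverseʳ; ¬-not) renaming (_≟_ to _≟ᵇ_)
open import Data.Nat using (ℕ; zero; suc; _+_; _≤_; _<_; z≤n; s≤s; _≡ᵇ_) renaming (_≟_ to _≟ℕ_)
open import Data.Nat.Properties
  using (≤-refl; ≤-reflexive; ≤-trans; +-assoc; +-identityʳ; +-mono-≤; +-monoˡ-≤; +-monoʳ-≤; +-cancelˡ-≡; <-irrefl;
         m≤m+n; m≤n+m; module ≤-Reasoning)
open import Data.Nat.Solver using (module +-*-Solver)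
open import Data.Nat.ListAction using (sum)
open import Data.Nat.ListAction.Properties using (sum-++; sum-↭)
open import Function using (_∘_; id)
import Algebra.Solver.CommutativeMonoid as CommutativeMonoidSolver
open import Data.Empty using (⊥; ⊥-elim)
open import Data.List using (List; []; _∷_; _++_; [_]; map; length; concatMap)
open import Data.List.Properties using (++-assoc; ++-identityʳ; ++-conicalʳ; length-++-≤ˡ; concatMap-++; map-++)
open import Data.List.Relation.Unary.All as All using (All; []; _∷_)
import Data.List.Relation.Unary.All.Properties as All
open import Data.List.Relation.Unary.Any using (Any; here; there)
import Data.List.Relation.Unary.Any.Properties as Any
open import Data.List.Membership.Propositional using (_∈_; _∉_; find)
open import Data.List.Membership.Propositional.Properties using (∈-map⁺; ∈-++⁺ˡ; ∈-++⁺ʳ; ∈-++⁻)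
open import Data.List.Relation.Binary.Subset.Propositional using (_⊆_)
open import Data.List.Relation.Binary.Subset.Propositional.Properties
  using (⊆-reflexive; ⊆-trans; ⊆-reflexive-↭; concatMap⁺; xs⊆ys++xs; xs⊆xs++ys; All-resp-⊇)
  renaming (++⁺ʳ to ++⁺ʳ-⊆)
open import Data.List.Relation.Binary.Permutation.Propositional
  using (_↭_; refl; prep; swap; ↭-sym; ↭-reflexive; ↭-trans)
open import Data.List.Relation.Binary.Permutation.Propositional.Properties
  using (++⁺ˡ; ++⁺ʳ; ++⁺; shift; shifts; ∷↭∷ʳ; ↭-empty-inv; drop-∷; Any-resp-↭; ∈-resp-↭; All-resp-↭; ↭-length; ++-commutativeMonoid)
  renaming (++-comm to ↭-++-comm; map⁺ to ↭-map⁺)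
open import Data.Product using (Σ; ∃; _×_; _,_; proj₁; proj₂)
open import Data.Product.Properties using (≡-dec)
open import Data.List.Membership.DecPropositional (≡-dec _≟ᵇ_ _≟ℕ_) using (_∈?_)
open import Relation.Nullary using (¬_; yes; no)
open import Relation.Nullary.Decidable using (isYes)
open import Data.Sum using (_⊎_; inj₁; inj₂; [_,_]′)
open import Relation.Binary.PropositionalEquality using (_≡_; _≢_; refl; sym; trans; cong; cong₂; subst; module ≡-Reasoning)

disabled : ∀ {b : Bool} → b ≡ false → b ≡ true → ⊥
disabled refl ()

to-front : ∀ (Γ : Sequent) A → Γ ++ [ A ] ↭ A ∷ Γ
to-front Γ A = ↭-sym (∷↭∷ʳ A Γ)

module ↭-Solver = CommutativeMonoidSolver (++-commutativeMonoid {A = Formula})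

-- Derivations and their invariants

module _ {S : System} {H H′ : Sequent → Set} (σ : ∀ {Γ} → H Γ → Deriv S H′ Γ) where

  graft : ∀ {Γ} → Deriv S H Γ → Deriv S H′ Γ
  graft-all : ∀ {ps} → All (Deriv S H) ps → All (Deriv S H′) ps
  graft (axiom p) = axiom p
  graft (leaf h) = σ h
  graft (exch π d) = exch π (graft d)
  graft (apply e i ds) = apply e i (graft-all ds)
  graft-all [] = []
  graft-all (d ∷ ds) = graft d ∷ graft-all ds

module _ {S T : System} (S⊇T : Contains S T) where

  lift : ∀ {H Γ} → Deriv T H Γ → Deriv S H Γ
  lift-all : ∀ {H ps} → All (Deriv T H) ps → All (Deriv S H) ps
  lift (axiom p) = axiom p
  lift (leaf h) = leaf h
  lift (exch π d) = exch π (lift d)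
  lift (apply {r} {ps} {c} e i ds) = graft (All.lookup (lift-all ds)) (S⊇T r e ps c i)
  lift-all [] = []
  lift-all (d ∷ ds) = lift d ∷ lift-all ds

  complete-mono : Complete T → Complete S
  complete-mono complete A valid = lift (complete A valid)

rule-derivable : ∀ {S r} → S r ≡ true → RuleDerivable S r
rule-derivable e ps c i = apply e i (All.tabulate leaf)

Preserves : Rule → (Sequent → Set) → Set
Preserves r P = ∀ {ps c} → Instance r ps c → All P ps → P c

module _ {S : System} (P : Sequent → Set)
         (P-axiom : ∀ p → P (pos p ∷ neg p ∷ []))
         (P-resp-↭ : ∀ {Γ Δ} → Γ ↭ Δ → P Γ → P Δ)
         (P-rules : ∀ {r} → S r ≡ true → Preserves r P) where

  invariant : ∀ {Γ} → Derivable S Γ → P Γ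
  invariant-all : ∀ {ps} → All (Derivable S) ps → All P ps
  invariant (axiom p) = P-axiom p
  invariant (exch π d) = P-resp-↭ π (invariant d)
  invariant (apply e i ds) = P-rules e i (invariant-all ds)
  invariant-all [] = []
  invariant-all (d ∷ ds) = invariant d ∷ invariant-all ds

  incomplete-by : ∀ A → Valid A → ¬ P [ A ] → ¬ Complete S
  incomplete-by A valid ¬P[A] complete = ¬P[A] (invariant (complete A valid))

∷ʳ≢[] : ∀ (Γ : Sequent) {A} → Γ ++ [ A ] ≢ []
∷ʳ≢[] [] ()
∷ʳ≢[] (_ ∷ _) ()

conclusion-nonempty : ∀ {r ps c} → Instance r ps c → c ≢ []
conclusion-nonempty (&-inst Γ _ _) = ∷ʳ≢[] Γ
conclusion-nonempty (⊗-inst Δ Σ _ _) e = ∷ʳ≢[] Σ (++-conicalʳ Δ _ e)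
conclusion-nonempty (∧-inst Γ Δ Σ _ _) e = ∷ʳ≢[] Σ (++-conicalʳ Δ _ (++-conicalʳ Γ _ e))
conclusion-nonempty (⊕₁-inst Γ _ _) = ∷ʳ≢[] Γ
conclusion-nonempty (⊕₂-inst Γ _ _) = ∷ʳ≢[] Γ
conclusion-nonempty (par-inst Γ _ _) = ∷ʳ≢[] Γ
conclusion-nonempty (W-inst _ _ _) ()
conclusion-nonempty (C-inst Γ _) = ∷ʳ≢[] Γ

derivable-nonempty : ∀ {S Γ} → Derivable S Γ → Γ ≢ []
derivable-nonempty = invariant (_≢ []) (λ _ ())
  (λ π Γ≢[] Δ≡[] → Γ≢[] (↭-empty-inv (subst (_ ↭_) Δ≡[] π)))
  (λ _ i _ → conclusion-nonempty i)

-- Derived rules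

module _ {S : System} {H : Sequent → Set} where

  contract-front : S Cr ≡ true → ∀ {A Γ} → Deriv S H (A ∷ A ∷ Γ) → Deriv S H (A ∷ Γ)
  contract-front e {A} {Γ} d =
    exch (to-front Γ A) (apply e (C-inst Γ A) (exch (↭-++-comm (A ∷ A ∷ []) Γ) d ∷ []))

  contract-prefix : S Cr ≡ true → ∀ Γ Σ → Deriv S H (Γ ++ Γ ++ Σ) → Deriv S H (Γ ++ Σ)
  contract-prefix e [] Σ d = d
  contract-prefix e (A ∷ Γ) Σ d =
    exch (shift A Γ Σ) (contract-prefix e Γ (A ∷ Σ) (exch (↭-sym A-in-front) (contract-front e d′)))
    where
    A-in-front : Γ ++ Γ ++ A ∷ Σ ↭ A ∷ Γ ++ Γ ++ Σ
    A-in-front = ↭-trans (++⁺ˡ Γ (shift A Γ Σ)) (shift A Γ (Γ ++ Σ))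
    d′ : Deriv S H (A ∷ A ∷ Γ ++ Γ ++ Σ)
    d′ = exch (prep A (shift A Γ (Γ ++ Σ))) d

  weaken-suffix : S Wr ≡ true → ∀ Σ {C Γ} → Deriv S H (C ∷ Γ) → Deriv S H (C ∷ Γ ++ Σ)
  weaken-suffix e [] {C} {Γ} d = subst (λ Δ → Deriv S H (C ∷ Δ)) (sym (++-identityʳ Γ)) d
  weaken-suffix e (A ∷ Σ) {C} {Γ} d =
    subst (λ Δ → Deriv S H (C ∷ Δ)) (++-assoc Γ [ A ] Σ)
      (weaken-suffix e Σ (apply e (W-inst C Γ A) (d ∷ [])))

  ∧-front : S ∧r ≡ true → ∀ {A B Γ Δ Σ} →
            Deriv S H (A ∷ Γ ++ Δ) → Deriv S H (B ∷ Γ ++ Σ) → Deriv S H (A ∧ B ∷ Γ ++ Δ ++ Σ)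
  ∧-front e {A} {B} {Γ} {Δ} {Σ} d₁ d₂ =
    exch (↭-trans (↭-reflexive (cong (Γ ++_) (sym (++-assoc Δ Σ _)))) (back Γ (Δ ++ Σ) (A ∧ B)))
      (apply e (∧-inst Γ Δ Σ A B) (exch (↭-sym (back Γ Δ A)) d₁ ∷ exch (↭-sym (back Γ Σ B)) d₂ ∷ []))
    where
    back : ∀ Γ Δ A → Γ ++ Δ ++ [ A ] ↭ A ∷ Γ ++ Δ
    back Γ Δ A = ↭-trans (↭-reflexive (sym (++-assoc Γ Δ [ A ]))) (to-front (Γ ++ Δ) A)

  ⊕₁-front : S ⊕r ≡ true → ∀ {A B Γ} → Deriv S H (A ∷ Γ) → Deriv S H ((A ∨ B) ∷ Γ)
  ⊕₁-front e {A} {B} {Γ} d =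
    exch (to-front Γ _) (apply e (⊕₁-inst Γ A B) (exch (↭-sym (to-front Γ A)) d ∷ []))

  ⊕₂-front : S ⊕r ≡ true → ∀ {A B Γ} → Deriv S H (B ∷ Γ) → Deriv S H ((A ∨ B) ∷ Γ)
  ⊕₂-front e {A} {B} {Γ} d =
    exch (to-front Γ _) (apply e (⊕₂-inst Γ A B) (exch (↭-sym (to-front Γ B)) d ∷ []))

  par-front : S parr ≡ true → ∀ {A B Γ} → Deriv S H (A ∷ B ∷ Γ) → Deriv S H ((A ∨ B) ∷ Γ)
  par-front e {A} {B} {Γ} d =
    exch (to-front Γ _) (apply e (par-inst Γ A B) (exch (↭-++-comm (A ∷ B ∷ []) Γ) d ∷ []))

module _ {S : System} where

  private
    premise : ∀ {Γ} → Deriv S (_∈ [ Γ ]) Γ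
    premise = leaf (here refl)
    premise₁ : ∀ {Γ Δ} → Deriv S (λ Θ → Θ ∈ Γ ∷ Δ ∷ []) Γ
    premise₁ = leaf (here refl)
    premise₂ : ∀ {Γ Δ} → Deriv S (λ Θ → Θ ∈ Γ ∷ Δ ∷ []) Δ
    premise₂ = leaf (there (here refl))

  &-from-∧ : S ∧r ≡ true → RuleDerivable S &r
  &-from-∧ e _ _ (&-inst Γ A B) = apply e (∧-inst Γ [] [] A B) (premise₁ ∷ premise₂ ∷ [])

  ⊗-from-∧ : S ∧r ≡ true → RuleDerivable S ⊗r
  ⊗-from-∧ e _ _ (⊗-inst Δ Σ A B) = apply e (∧-inst [] Δ Σ A B) (premise₁ ∷ premise₂ ∷ [])

  &-from-⊗-C : S ⊗r ≡ true → S Cr ≡ true → RuleDerivable S &r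
  &-from-⊗-C e c _ _ (&-inst Γ A B) =
    contract-prefix c Γ [ A ∧ B ] (apply e (⊗-inst Γ Γ A B) (premise₁ ∷ premise₂ ∷ []))

  ∧-from-⊗-C : S ⊗r ≡ true → S Cr ≡ true → RuleDerivable S ∧r
  ∧-from-⊗-C e c _ _ (∧-inst Γ Δ Σ A B) =
    contract-prefix c Γ (Δ ++ Σ ++ [ A ∧ B ]) (exch regroup (apply e (⊗-inst (Γ ++ Δ) (Γ ++ Σ) A B)
      (exch (↭-reflexive (sym (++-assoc Γ Δ [ A ]))) premise₁ ∷
       exch (↭-reflexive (sym (++-assoc Γ Σ [ B ]))) premise₂ ∷ [])))
    where
    regroup : (Γ ++ Δ) ++ (Γ ++ Σ) ++ [ A ∧ B ] ↭ Γ ++ Γ ++ Δ ++ Σ ++ [ A ∧ B ]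
    regroup = ↭-trans (↭-reflexive (trans (++-assoc Γ Δ _) (cong (λ Θ → Γ ++ Δ ++ Θ) (++-assoc Γ Σ _))))
                      (++⁺ˡ Γ (shifts Δ Γ))

  ⊕-from-par-W : S parr ≡ true → S Wr ≡ true → RuleDerivable S ⊕r
  ⊕-from-par-W p w _ _ (⊕₁-inst Γ A₁ A₂) =
    apply p (par-inst Γ A₁ A₂)
      (exch (↭-sym (shift A₁ Γ [ A₂ ])) (apply w (W-inst A₁ Γ A₂) (exch (to-front Γ A₁) premise ∷ [])) ∷ [])
  ⊕-from-par-W p w _ _ (⊕₂-inst Γ A₁ A₂) =
    apply p (par-inst Γ A₁ A₂)
      (exch (↭-trans (↭-sym (shift A₂ Γ [ A₁ ])) (++⁺ˡ Γ (swap A₂ A₁ refl)))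
        (apply w (W-inst A₂ Γ A₁) (exch (to-front Γ A₂) premise ∷ [])) ∷ [])

  par-from-⊕-C : S ⊕r ≡ true → S Cr ≡ true → RuleDerivable S parr
  par-from-⊕-C o c _ _ (par-inst Γ A B) =
    exch (↭-sym (to-front Γ (A ∨ B))) (contract-front c (⊕₁-front o (exch (swap (A ∨ B) A refl) (⊕₂-front o
      (exch (↭-trans (↭-++-comm Γ (A ∷ B ∷ [])) (swap A B refl)) premise)))))

  ⊗-from-&-W : S &r ≡ true → S Wr ≡ true → RuleDerivable S ⊗r
  ⊗-from-&-W k w _ _ (⊗-inst Δ Σ A B) =
    exch (↭-reflexive (++-assoc Δ Σ _)) (apply k (&-inst (Δ ++ Σ) A B) (left ∷ right ∷ []))
    where
    left = exch (↭-sym (to-front (Δ ++ Σ) A)) (weaken-suffix w Σ (exch (to-front Δ A) premise₁))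
    right = exch (↭-trans (↭-sym (to-front (Σ ++ Δ) B)) (++⁺ʳ [ B ] (↭-++-comm Σ Δ)))
              (weaken-suffix w Δ (exch (to-front Σ B) premise₂))

  ∧-from-&-W : S &r ≡ true → S Wr ≡ true → RuleDerivable S ∧r
  ∧-from-&-W k w _ _ (∧-inst Γ Δ Σ A B) =
    exch (↭-reflexive (trans (++-assoc Γ (Δ ++ Σ) _) (cong (Γ ++_) (++-assoc Δ Σ _))))
      (apply k (&-inst (Γ ++ Δ ++ Σ) A B) (left ∷ right ∷ []))
    where
    front : ∀ Δ C → Γ ++ Δ ++ [ C ] ↭ C ∷ Γ ++ Δ
    front Δ C = ↭-trans (↭-reflexive (sym (++-assoc Γ Δ [ C ]))) (to-front (Γ ++ Δ) C)
    left = exch (↭-trans (↭-reflexive (cong (A ∷_) (++-assoc Γ Δ Σ))) (↭-sym (to-front (Γ ++ Δ ++ Σ) A)))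
             (weaken-suffix w Σ (exch (front Δ A) premise₁))
    right = exch (↭-trans (↭-reflexive (cong (B ∷_) (++-assoc Γ Σ Δ)))
                   (↭-trans (prep B (++⁺ˡ Γ (↭-++-comm Σ Δ))) (↭-sym (to-front (Γ ++ Δ ++ Σ) B))))
              (weaken-suffix w Δ (exch (front Σ B) premise₂))

GS1p-contains : ∀ {T} → Contains GS1p T
GS1p-contains ⊗r _ = ⊗-from-&-W refl refl
GS1p-contains ∧r _ = ∧-from-&-W refl refl
GS1p-contains &r _ = rule-derivable refl
GS1p-contains ⊕r _ = rule-derivable refl
GS1p-contains parr _ = par-from-⊕-C refl refl
GS1p-contains Cr _ = rule-derivable refl
GS1p-contains Wr _ = rule-derivable refl

Np-contains : ∀ {T} → T Cr ≡ false → Contains Np T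
Np-contains _ ⊗r _ = ⊗-from-&-W refl refl
Np-contains _ ∧r _ = ∧-from-&-W refl refl
Np-contains _ &r _ = rule-derivable refl
Np-contains _ ⊕r _ = ⊕-from-par-W refl refl
Np-contains _ parr _ = rule-derivable refl
Np-contains no-C Cr on = ⊥-elim (disabled no-C on)
Np-contains _ Wr _ = rule-derivable refl

Pp-contains : ∀ {T} → T Wr ≡ false → Contains Pp T
Pp-contains _ ⊗r _ = rule-derivable refl
Pp-contains _ ∧r _ = ∧-from-⊗-C refl refl
Pp-contains _ &r _ = &-from-⊗-C refl refl
Pp-contains _ ⊕r _ = rule-derivable refl
Pp-contains _ parr _ = par-from-⊕-C refl refl
Pp-contains _ Cr _ = rule-derivable refl
Pp-contains no-W Wr on = ⊥-elim (disabled no-W on)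

Mp-contains : ∀ {T} → T Cr ≡ false → T Wr ≡ false → Contains Mp T
Mp-contains _ _ ⊗r _ = ⊗-from-∧ refl
Mp-contains _ _ ∧r _ = rule-derivable refl
Mp-contains _ _ &r _ = &-from-∧ refl
Mp-contains _ _ ⊕r _ = rule-derivable refl
Mp-contains _ _ parr _ = rule-derivable refl
Mp-contains no-C _ Cr on = ⊥-elim (disabled no-C on)
Mp-contains _ no-W Wr on = ⊥-elim (disabled no-W on)

-- Completeness of Mp

Mask : Set
Mask = ℕ → Bool

infixr 5 _◂_
_◂_ : Bool → Mask → Mask
(b ◂ m) zero = b
(b ◂ m) (suc i) = m i

infix 6 _∩_ _∖_ _∪_
_∩_ _∖_ _∪_ : Mask → Mask → Mask
(m ∩ k) i = m i && k i
(m ∖ k) i = m i && not (k i)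
(m ∪ k) i = m i || k i

keep : ∀ {A : Set} → Bool → A → List A → List A
keep true x xs = x ∷ xs
keep false x xs = xs

select : ∀ {A : Set} → Mask → List A → List A
select m [] = []
select m (x ∷ xs) = keep (m 0) x (select (m ∘ suc) xs)

select-none : ∀ {A : Set} (xs : List A) → select (λ _ → false) xs ≡ []
select-none [] = refl
select-none (x ∷ xs) = select-none xs

select-cong : ∀ {A : Set} {m k} → (∀ i → m i ≡ k i) → (xs : List A) → select m xs ≡ select k xs
select-cong eq [] = refl
select-cong eq (y ∷ xs) = cong₂ (λ b ys → keep b y ys) (eq 0) (select-cong (eq ∘ suc) xs)

select-split : ∀ {A : Set} m k (xs : List A) → select m xs ↭ select (m ∩ k) xs ++ select (m ∖ k) xs
select-split m k [] = refl
select-split m k (x ∷ xs) with m 0 | k 0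
... | true | true = prep x (select-split (m ∘ suc) (k ∘ suc) xs)
... | true | false =
  ↭-trans (prep x (select-split (m ∘ suc) (k ∘ suc) xs)) (↭-sym (shift x (select ((m ∘ suc) ∩ (k ∘ suc)) xs) _))
... | false | _ = select-split (m ∘ suc) (k ∘ suc) xs

interleave : ∀ {A : Set} (a b c d : List A) → (a ++ b) ++ (c ++ d) ↭ (a ++ c) ++ (b ++ d)
interleave a b c d = ↭-trans (↭-reflexive (++-assoc a b (c ++ d)))
                      (↭-trans (++⁺ˡ a (shifts b c)) (↭-reflexive (sym (++-assoc a c (b ++ d)))))

Choice : Set
Choice = Mask × Mask

lift₂ : (Mask → Mask → Mask) → Choice → Choice → Choice
lift₂ _•_ (m , k) (m′ , k′) = (m • m′ , k • k′)

module Choices (T Θ : Sequent) where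

  chosen : Choice → Sequent
  chosen (m , k) = select m T ++ select k Θ

  chosen-split : ∀ c c′ → chosen c ↭ chosen (lift₂ _∩_ c c′) ++ chosen (lift₂ _∖_ c c′)
  chosen-split (m , k) (m′ , k′) =
    ↭-trans (++⁺ (select-split m m′ T) (select-split k k′ Θ))
      (interleave (select (m ∩ m′) T) (select (m ∖ m′) T) (select (k ∩ k′) Θ) (select (k ∖ k′) Θ))

  chosen-∩-comm : ∀ c c′ → chosen (lift₂ _∩_ c c′) ≡ chosen (lift₂ _∩_ c′ c)
  chosen-∩-comm (m , k) (m′ , k′) =
    cong₂ _++_ (select-cong (λ i → ∧-comm (m i) (m′ i)) T) (select-cong (λ i → ∧-comm (k i) (k′ i)) Θ)

  chosen-∪ : ∀ c c′ → chosen (lift₂ _∪_ c c′) ↭ chosen c ++ chosen (lift₂ _∖_ c′ c)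
  chosen-∪ c@(m , k) c′@(m′ , k′) =
    ↭-trans (chosen-split (lift₂ _∪_ c c′) c)
      (↭-reflexive (cong₂ _++_ (cong₂ _++_ (select-cong (λ i → ∪-∩-absorb (m i) (m′ i)) T)
                                             (select-cong (λ i → ∪-∩-absorb (k i) (k′ i)) Θ))
                               (cong₂ _++_ (select-cong (λ i → ∪-∖ (m i) (m′ i)) T)
                                             (select-cong (λ i → ∪-∖ (k i) (k′ i)) Θ))))
    where
    ∪-∩-absorb : ∀ a b → (a || b) && a ≡ a
    ∪-∩-absorb true b = refl
    ∪-∩-absorb false b = ∧-zeroʳ b
    ∪-∖ : ∀ a b → (a || b) && not a ≡ b && not a
    ∪-∖ true b = sym (∧-zeroʳ b)
    ∪-∖ false b = refl

  chosen-union : ∀ c c′ → chosen (lift₂ _∪_ c c′) ↭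
                 chosen (lift₂ _∩_ c c′) ++ chosen (lift₂ _∖_ c c′) ++ chosen (lift₂ _∖_ c′ c)
  chosen-union c c′ = ↭-trans (chosen-∪ c c′)
    (↭-trans (++⁺ʳ _ (chosen-split c c′))
      (↭-reflexive (++-assoc (chosen (lift₂ _∩_ c c′)) (chosen (lift₂ _∖_ c c′)) _)))

literal : Bool × ℕ → Formula
literal (true , p) = pos p
literal (false , p) = neg p

ValidSequent : Sequent → Set
ValidSequent Γ = ∀ v → Any (λ A → eval v A ≡ true) Γ

-- Read P as true exactly when P̄ occurs: then a true literal of L is some P whose P̄ occurs too.
complementary-pair : ∀ L → ValidSequent (map literal L) → ∃ λ q → (true , q) ∈ L × (false , q) ∈ L
complementary-pair L valid = let (l , l∈L , true-at-v) = find (Any.map⁻ (valid v)) in complement l∈L true-at-v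
  where
  v : ℕ → Bool
  v p = isYes ((false , p) ∈? L)
  complement : ∀ {l} → l ∈ L → eval v (literal l) ≡ true → ∃ λ q → (true , q) ∈ L × (false , q) ∈ L
  complement {true , q} t∈L h with (false , q) ∈? L
  ... | yes f∈L = q , t∈L , f∈L
  complement {false , q} f∈L h with (false , q) ∈? L
  ... | no f∉L = ⊥-elim (f∉L f∈L)

only : ∀ {A : Set} {x : A} {xs} → x ∈ xs → Mask
only (here _) = true ◂ λ _ → false
only (there i) = false ◂ only i

select-only : ∀ {A : Set} {x : A} {xs} (i : x ∈ xs) → select (only i) xs ≡ [ x ]
select-only {xs = _ ∷ xs} (here refl) = cong (_ ∷_) (select-none xs)
select-only (there i) = select-only i

select-two : ∀ {A : Set} {x y : A} {xs} → x ∈ xs → y ∈ xs → x ≢ y → ∃ λ k → select k xs ↭ x ∷ y ∷ []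
select-two (here refl) (here refl) x≢y = ⊥-elim (x≢y refl)
select-two (here refl) (there j) _ = (true ◂ only j) , ↭-reflexive (cong (_ ∷_) (select-only j))
select-two (there i) (here refl) _ =
  (true ◂ only i) , ↭-trans (↭-reflexive (cong (_ ∷_) (select-only i))) (swap _ _ refl)
select-two (there i) (there j) x≢y = let (k , π) = select-two i j x≢y in (false ◂ k) , π

literals-sub-derivable : ∀ L → ValidSequent (map literal L) → ∃ λ k → Derivable Mp (select k (map literal L))
literals-sub-derivable L valid =
  let (q , t∈L , f∈L) = complementary-pair L valid
      (k , π) = select-two (∈-map⁺ literal t∈L) (∈-map⁺ literal f∈L) (λ ())
  in k , exch (↭-sym π) (axiom q)

valid-literal : ∀ {l T L} → ValidSequent (literal l ∷ T ++ map literal L) → ValidSequent (T ++ map literal (l ∷ L))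
valid-literal {l} {T} valid v = Any-resp-↭ (↭-sym (shift (literal l) T _)) (valid v)

valid-∧ˡ : ∀ {A B Γ} → ValidSequent ((A ∧ B) ∷ Γ) → ValidSequent (A ∷ Γ)
valid-∧ˡ valid v with valid v
... | here h = here (∧-conicalˡ _ _ h)
... | there h = there h

valid-∧ʳ : ∀ {A B Γ} → ValidSequent ((A ∧ B) ∷ Γ) → ValidSequent (B ∷ Γ)
valid-∧ʳ valid v with valid v
... | here h = here (∧-conicalʳ _ _ h)
... | there h = there h

valid-∨ : ∀ {A B Γ} → ValidSequent ((A ∨ B) ∷ Γ) → ValidSequent (A ∷ B ∷ Γ)
valid-∨ {A} valid v with valid v
... | there h = there (there h)
... | here h with eval v A in A-true
...   | true = here A-true
...   | false = there (here h)

SubDerivable : List Formula → List (Bool × ℕ) → Set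
SubDerivable T L = Σ Choice λ c → Derivable Mp (Choices.chosen T (map literal L) c)

keep-shift : ∀ {A : Set} b (x : A) xs ys → xs ++ keep b x ys ↭ keep b x xs ++ ys
keep-shift true x xs ys = shift x xs ys
keep-shift false x xs ys = refl

move-literal : ∀ l {T L} → SubDerivable T (l ∷ L) → SubDerivable (literal l ∷ T) L
move-literal l {T} {L} ((m , k) , d) =
  ((k 0 ◂ m) , k ∘ suc) , exch (keep-shift (k 0) (literal l) (select m T) _) d

combine-∨ : ∀ {A B T L} → SubDerivable (A ∷ B ∷ T) L → SubDerivable ((A ∨ B) ∷ T) L
combine-∨ {A} {B} {T} {L} ((m , k) , d) = join (m 0) (m 1) d
  where
  Γ = select (m ∘ suc ∘ suc) T
  Θ = select k (map literal L)
  join : ∀ b₁ b₂ → Derivable Mp (keep b₁ A (keep b₂ B Γ) ++ Θ) → SubDerivable ((A ∨ B) ∷ T) L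
  join true true d = ((true ◂ m ∘ suc ∘ suc) , k) , par-front refl d
  join true false d = ((true ◂ m ∘ suc ∘ suc) , k) , ⊕₁-front refl d
  join false true d = ((true ◂ m ∘ suc ∘ suc) , k) , ⊕₂-front refl d
  join false false d = ((false ◂ m ∘ suc ∘ suc) , k) , d

-- If both sides use their conjunct, the mixed rule shares what the two choices have in common.
combine-∧ : ∀ {A B T L} → SubDerivable (A ∷ T) L → SubDerivable (B ∷ T) L → SubDerivable ((A ∧ B) ∷ T) L
combine-∧ {A} {B} {T} {L} ((m₁ , k₁) , d₁) ((m₂ , k₂) , d₂) = join (m₁ 0) (m₂ 0) d₁ d₂
  where
  open Choices T (map literal L)
  c₁ c₂ : Choice
  c₁ = (m₁ ∘ suc , k₁)
  c₂ = (m₂ ∘ suc , k₂)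
  join : ∀ b₁ b₂ → Derivable Mp (keep b₁ A (select (m₁ ∘ suc) T) ++ select k₁ (map literal L)) →
         Derivable Mp (keep b₂ B (select (m₂ ∘ suc) T) ++ select k₂ (map literal L)) →
         SubDerivable ((A ∧ B) ∷ T) L
  join false _ d₁ _ = ((false ◂ m₁ ∘ suc) , k₁) , d₁
  join true false _ d₂ = ((false ◂ m₂ ∘ suc) , k₂) , d₂
  join true true d₁ d₂ =
    ((true ◂ m₁ ∘ suc ∪ m₂ ∘ suc) , k₁ ∪ k₂) ,
    exch (prep (A ∧ B) (↭-sym (chosen-union c₁ c₂)))
      (∧-front refl {A} {B} {common} {only₁} {only₂} (exch (prep A (chosen-split c₁ c₂)) d₁)
        (exch (prep B (↭-trans (chosen-split c₂ c₁) (↭-reflexive (cong (_++ only₂) (chosen-∩-comm c₂ c₁))))) d₂))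
    where
    common = chosen (lift₂ _∩_ c₁ c₂)
    only₁ = chosen (lift₂ _∖_ c₁ c₂)
    only₂ = chosen (lift₂ _∖_ c₂ c₁)

size : Formula → ℕ
size (pos _) = 1
size (neg _) = 1
size (A ∧ B) = suc (size A + size B)
size (A ∨ B) = suc (size A + size B)

sub-derivable : ∀ n T L → sum (map size T) ≤ n → ValidSequent (T ++ map literal L) → SubDerivable T L
sub-derivable n [] L _ valid = let (k , d) = literals-sub-derivable L valid in ((λ _ → false) , k) , d
sub-derivable zero (pos _ ∷ _) _ () _
sub-derivable zero (neg _ ∷ _) _ () _
sub-derivable zero ((_ ∧ _) ∷ _) _ () _
sub-derivable zero ((_ ∨ _) ∷ _) _ () _
sub-derivable (suc n) (pos q ∷ T) L (s≤s le) valid =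
  move-literal (true , q) {T} {L} (sub-derivable n T _ le (valid-literal valid))
sub-derivable (suc n) (neg q ∷ T) L (s≤s le) valid =
  move-literal (false , q) {T} {L} (sub-derivable n T _ le (valid-literal valid))
sub-derivable (suc n) ((A ∧ B) ∷ T) L (s≤s le) valid =
  combine-∧ {A} {B} {T} {L} (sub-derivable n (A ∷ T) L (≤-trans (+-monoˡ-≤ _ (m≤m+n (size A) (size B))) le) (valid-∧ˡ valid))
            (sub-derivable n (B ∷ T) L (≤-trans (+-monoˡ-≤ _ (m≤n+m (size B) (size A))) le) (valid-∧ʳ valid))
sub-derivable (suc n) ((A ∨ B) ∷ T) L (s≤s le) valid =
  combine-∨ {A} {B} {T} {L} (sub-derivable n (A ∷ B ∷ T) L (subst (_≤ n) (+-assoc (size A) _ _) le) (valid-∨ valid))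

Mp-complete : Complete Mp
Mp-complete A valid with sub-derivable _ [ A ] [] ≤-refl (λ v → here (valid v))
... | (m , _) , d = all-of (m 0) d
  where
  all-of : ∀ b → Derivable Mp (keep b A [] ++ []) → Derivable Mp [ A ]
  all-of true d = d
  all-of false d = ⊥-elim (derivable-nonempty d refl)

-- Incomplete systems

module AnyFormula (Q : Formula → Set) where

  private
    last⁻ : ∀ Γ {A} → Any Q (Γ ++ [ A ]) → Any Q Γ ⊎ Q A
    last⁻ Γ h with Any.++⁻ Γ h
    ... | inj₁ q = inj₁ q
    ... | inj₂ (here q) = inj₂ q

  any-W : Preserves Wr (Any Q)
  any-W (W-inst _ _ _) (h ∷ []) = Any.++⁺ˡ h

  any-C : Preserves Cr (Any Q)
  any-C (C-inst Γ _) (h ∷ []) with Any.++⁻ Γ h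
  ... | inj₁ q = Any.++⁺ˡ q
  ... | inj₂ (here q) = Any.++⁺ʳ Γ (here q)
  ... | inj₂ (there (here q)) = Any.++⁺ʳ Γ (here q)

  module _ (∧-closed : ∀ {A B} → Q A → Q B → Q (A ∧ B)) where

    any-& : Preserves &r (Any Q)
    any-& (&-inst Γ _ _) (h₁ ∷ h₂ ∷ []) with last⁻ Γ h₁ | last⁻ Γ h₂
    ... | inj₁ q | _ = Any.++⁺ˡ q
    ... | inj₂ _ | inj₁ q = Any.++⁺ˡ q
    ... | inj₂ a | inj₂ b = Any.++⁺ʳ Γ (here (∧-closed a b))

    any-⊗ : Preserves ⊗r (Any Q)
    any-⊗ (⊗-inst Δ Σ _ _) (h₁ ∷ h₂ ∷ []) with last⁻ Δ h₁ | last⁻ Σ h₂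
    ... | inj₁ q | _ = Any.++⁺ˡ q
    ... | inj₂ _ | inj₁ q = Any.++⁺ʳ Δ (Any.++⁺ˡ q)
    ... | inj₂ a | inj₂ b = Any.++⁺ʳ Δ (Any.++⁺ʳ Σ (here (∧-closed a b)))

    any-∧ : Preserves ∧r (Any Q)
    any-∧ (∧-inst Γ Δ Σ _ _) (h₁ ∷ h₂ ∷ []) with Any.++⁻ Γ h₁ | Any.++⁻ Γ h₂
    ... | inj₁ q | _ = Any.++⁺ˡ q
    ... | inj₂ _ | inj₁ q = Any.++⁺ˡ q
    ... | inj₂ h₁′ | inj₂ h₂′ with last⁻ Δ h₁′ | last⁻ Σ h₂′
    ...   | inj₁ q | _ = Any.++⁺ʳ Γ (Any.++⁺ˡ q)
    ...   | inj₂ _ | inj₁ q = Any.++⁺ʳ Γ (Any.++⁺ʳ Δ (Any.++⁺ˡ q))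
    ...   | inj₂ a | inj₂ b = Any.++⁺ʳ Γ (Any.++⁺ʳ Δ (Any.++⁺ʳ Σ (here (∧-closed a b))))

  module _ (∨-closedˡ : ∀ {A B} → Q A → Q (A ∨ B)) (∨-closedʳ : ∀ {A B} → Q B → Q (A ∨ B)) where

    any-⊕ : Preserves ⊕r (Any Q)
    any-⊕ (⊕₁-inst Γ _ _) (h ∷ []) with last⁻ Γ h
    ... | inj₁ q = Any.++⁺ˡ q
    ... | inj₂ a = Any.++⁺ʳ Γ (here (∨-closedˡ a))
    any-⊕ (⊕₂-inst Γ _ _) (h ∷ []) with last⁻ Γ h
    ... | inj₁ q = Any.++⁺ˡ q
    ... | inj₂ b = Any.++⁺ʳ Γ (here (∨-closedʳ b))

    any-par : Preserves parr (Any Q)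
    any-par (par-inst Γ _ _) (h ∷ []) with Any.++⁻ Γ h
    ... | inj₁ q = Any.++⁺ˡ q
    ... | inj₂ (here a) = Any.++⁺ʳ Γ (here (∨-closedˡ a))
    ... | inj₂ (there (here b)) = Any.++⁺ʳ Γ (here (∨-closedʳ b))

excluded-middle : ∀ p → Valid (pos p ∨ neg p)
excluded-middle p v = ∨-inverseʳ (v p)

data ∨-Free : Formula → Set where
  pos : ∀ {p} → ∨-Free (pos p)
  neg : ∀ {p} → ∨-Free (neg p)
  _∧_ : ∀ {A B} → ∨-Free A → ∨-Free B → ∨-Free (A ∧ B)

incomplete-without-disjunction : ∀ {S} → S ⊕r ≡ false → S parr ≡ false → ¬ Complete S
incomplete-without-disjunction {S} no-⊕ no-par =
  incomplete-by (Any ∨-Free) (λ _ → here pos) Any-resp-↭ rules (pos 0 ∨ neg 0) (excluded-middle 0)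
    λ { (here ()) ; (there ()) }
  where
  open AnyFormula ∨-Free
  rules : ∀ {r} → S r ≡ true → Preserves r (Any ∨-Free)
  rules {⊗r} _ = any-⊗ _∧_
  rules {∧r} _ = any-∧ _∧_
  rules {&r} _ = any-& _∧_
  rules {⊕r} on = ⊥-elim (disabled no-⊕ on)
  rules {parr} on = ⊥-elim (disabled no-par on)
  rules {Cr} _ = any-C
  rules {Wr} _ = any-W

-- Truth at v when every conjunction is read as false.
data TrueDisjunct (v : ℕ → Bool) : Formula → Set where
  pos : ∀ {p} → v p ≡ true → TrueDisjunct v (pos p)
  neg : ∀ {p} → v p ≡ false → TrueDisjunct v (neg p)
  ∨ˡ : ∀ {A B} → TrueDisjunct v A → TrueDisjunct v (A ∨ B)
  ∨ʳ : ∀ {A B} → TrueDisjunct v B → TrueDisjunct v (A ∨ B)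

incomplete-without-conjunction : ∀ {S} → S &r ≡ false → S ∧r ≡ false → S ⊗r ≡ false → ¬ Complete S
incomplete-without-conjunction {S} no-& no-∧ no-⊗ =
  incomplete-by Holds axiom-holds (λ π h v → Any-resp-↭ π (h v))
    (λ on i hs v → rules v on i (All.map (λ h → h v) hs))
    ((pos 0 ∧ pos 0) ∨ neg 0) valid (λ h → fails (h (λ _ → true)))
  where
  Holds : Sequent → Set
  Holds Γ = ∀ v → Any (TrueDisjunct v) Γ
  axiom-holds : ∀ p → Holds (pos p ∷ neg p ∷ [])
  axiom-holds p v with v p in e
  ... | true = here (pos e)
  ... | false = there (here (neg e))
  rules : ∀ v {r} → S r ≡ true → Preserves r (Any (TrueDisjunct v))
  rules v {⊗r} on = ⊥-elim (disabled no-⊗ on)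
  rules v {∧r} on = ⊥-elim (disabled no-∧ on)
  rules v {&r} on = ⊥-elim (disabled no-& on)
  rules v {⊕r} _ = AnyFormula.any-⊕ (TrueDisjunct v) ∨ˡ ∨ʳ
  rules v {parr} _ = AnyFormula.any-par (TrueDisjunct v) ∨ˡ ∨ʳ
  rules v {Cr} _ = AnyFormula.any-C (TrueDisjunct v)
  rules v {Wr} _ = AnyFormula.any-W (TrueDisjunct v)
  valid : Valid ((pos 0 ∧ pos 0) ∨ neg 0)
  valid v with v 0
  ... | true = refl
  ... | false = refl
  fails : ¬ Any (TrueDisjunct (λ _ → true)) [ (pos 0 ∧ pos 0) ∨ neg 0 ]
  fails (here (∨ʳ (neg ())))

length-∷ʳ-mono : ∀ (Γ Δ Σ : Sequent) {A B} → length (Γ ++ Δ ++ [ A ]) ≤ length (Γ ++ Δ ++ Σ ++ [ B ])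
length-∷ʳ-mono (_ ∷ Γ) Δ Σ = s≤s (length-∷ʳ-mono Γ Δ Σ)
length-∷ʳ-mono [] (_ ∷ Δ) Σ = s≤s (length-∷ʳ-mono [] Δ Σ)
length-∷ʳ-mono [] [] [] = s≤s z≤n
length-∷ʳ-mono [] [] (_ ∷ _) = s≤s z≤n

incomplete-without-par-and-C : ∀ {S} → S parr ≡ false → S Cr ≡ false → ¬ Complete S
incomplete-without-par-and-C {S} no-par no-C =
  incomplete-by (λ Γ → 2 ≤ length Γ) (λ _ → s≤s (s≤s z≤n)) (λ π → subst (2 ≤_) (↭-length π)) rules
    (pos 0 ∨ neg 0) (excluded-middle 0) λ { (s≤s ()) }
  where
  rules : ∀ {r} → S r ≡ true → Preserves r (λ Γ → 2 ≤ length Γ)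
  rules _ (&-inst Γ _ _) (h ∷ _) = ≤-trans h (length-∷ʳ-mono [] Γ [])
  rules _ (⊗-inst Δ Σ _ _) (h ∷ _) = ≤-trans h (length-∷ʳ-mono [] Δ Σ)
  rules _ (∧-inst Γ Δ Σ _ _) (h ∷ _) = ≤-trans h (length-∷ʳ-mono Γ Δ Σ)
  rules _ (⊕₁-inst Γ _ _) (h ∷ _) = ≤-trans h (length-∷ʳ-mono [] Γ [])
  rules _ (⊕₂-inst Γ _ _) (h ∷ _) = ≤-trans h (length-∷ʳ-mono [] Γ [])
  rules on (par-inst _ _ _) _ = ⊥-elim (disabled no-par on)
  rules _ (W-inst _ Γ _) (h ∷ _) = ≤-trans h (s≤s (length-++-≤ˡ Γ))
  rules on (C-inst _ _) _ = ⊥-elim (disabled no-C on)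

literals : Formula → List Formula
literals (pos p) = [ pos p ]
literals (neg p) = [ neg p ]
literals (A ∧ B) = literals A ++ literals B
literals (A ∨ B) = literals A ++ literals B

literalsₛ : Sequent → List Formula
literalsₛ = concatMap literals

record ComplementClosed (Γ : Sequent) : Set where
  constructor closed
  field complement : ∀ {ℓ} → ℓ ∈ literalsₛ Γ → ¬f ℓ ∈ literalsₛ Γ

infix 4 _≈ₗ_
record _≈ₗ_ (Γ Δ : Sequent) : Set where
  constructor _,_
  field
    to : literalsₛ Γ ⊆ literalsₛ Δ
    from : literalsₛ Δ ⊆ literalsₛ Γ

infixr 5 _⨾_
_⨾_ : ∀ {Γ Δ Θ} → Γ ≈ₗ Δ → Δ ≈ₗ Θ → Γ ≈ₗ Θ
(Γ⊆Δ , Δ⊆Γ) ⨾ (Δ⊆Θ , Θ⊆Δ) = ⊆-trans Γ⊆Δ Δ⊆Θ , ⊆-trans Θ⊆Δ Δ⊆Γ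

≈ₗ-↭ : ∀ {Γ Δ} → Γ ↭ Δ → Γ ≈ₗ Δ
≈ₗ-↭ π = concatMap⁺ literals (⊆-reflexive-↭ π) , concatMap⁺ literals (⊆-reflexive-↭ (↭-sym π))

≈ₗ-dup : ∀ Γ Δ → Γ ++ Γ ++ Δ ≈ₗ Γ ++ Δ
≈ₗ-dup Γ Δ = concatMap⁺ literals (λ x∈ → [ ∈-++⁺ˡ , id ]′ (∈-++⁻ Γ x∈)) ,
             concatMap⁺ literals (xs⊆ys++xs (Γ ++ Δ) Γ)

≈ₗ-split : ∀ {A B} C Γ → literals C ≡ literals A ++ literals B → A ∷ B ∷ Γ ≈ₗ C ∷ Γ
≈ₗ-split {A} {B} C Γ eq = ⊆-reflexive (sym lits) , ⊆-reflexive lits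
  where
  lits : literalsₛ (C ∷ Γ) ≡ literalsₛ (A ∷ B ∷ Γ)
  lits = trans (cong (_++ literalsₛ Γ) eq) (++-assoc (literals A) (literals B) (literalsₛ Γ))

closed-resp : ∀ {Γ Δ} → Γ ≈ₗ Δ → ComplementClosed Γ → ComplementClosed Δ
closed-resp (Γ⊆Δ , Δ⊆Γ) (closed complement) = closed (Γ⊆Δ ∘ complement ∘ Δ⊆Γ)

closed-++ : ∀ {Γ Δ} → ComplementClosed Γ → ComplementClosed Δ → ComplementClosed (Γ ++ Δ)
closed-++ {Γ} {Δ} (closed complementΓ) (closed complementΔ) =
  closed (out ∘ [ ∈-++⁺ˡ ∘ complementΓ , ∈-++⁺ʳ (literalsₛ Γ) ∘ complementΔ ]′ ∘ ∈-++⁻ (literalsₛ Γ) ∘ into)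
  where
  into : ∀ {ℓ} → ℓ ∈ literalsₛ (Γ ++ Δ) → ℓ ∈ literalsₛ Γ ++ literalsₛ Δ
  into = subst (_ ∈_) (concatMap-++ literals Γ Δ)
  out : ∀ {ℓ} → ℓ ∈ literalsₛ Γ ++ literalsₛ Δ → ℓ ∈ literalsₛ (Γ ++ Δ)
  out = subst (_ ∈_) (sym (concatMap-++ literals Γ Δ))

closed-∧ : ∀ Γ Δ {p₁ p₂ A B c} → p₁ ++ p₂ ↭ Γ ++ Γ ++ A ∷ B ∷ Δ → (A ∧ B) ∷ Γ ++ Δ ↭ c →
           ComplementClosed p₁ → ComplementClosed p₂ → ComplementClosed c
closed-∧ Γ Δ {A = A} {B} π ρ c₁ c₂ = closed-resp
  (≈ₗ-↭ π ⨾ ≈ₗ-dup Γ (A ∷ B ∷ Δ) ⨾ ≈ₗ-↭ (shifts Γ (A ∷ B ∷ [])) ⨾ ≈ₗ-split (A ∧ B) (Γ ++ Δ) refl ⨾ ≈ₗ-↭ ρ)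
  (closed-++ c₁ c₂)

incomplete-without-⊕-and-W : ∀ {S} → S ⊕r ≡ false → S Wr ≡ false → ¬ Complete S
incomplete-without-⊕-and-W {S} no-⊕ no-W =
  incomplete-by ComplementClosed axiom-closed (closed-resp ∘ ≈ₗ-↭) rules
    ((pos 0 ∨ neg 0) ∨ pos 1) (λ v → cong (_|| v 1) (excluded-middle 0 v)) (λ c → absent (ComplementClosed.complement c present))
  where
  open ↭-Solver using (solve; _⊕_; _⊜_) renaming (id to ∅)
  axiom-closed : ∀ p → ComplementClosed (pos p ∷ neg p ∷ [])
  axiom-closed p = closed λ { (here refl) → there (here refl) ; (there (here refl)) → here refl }
  rules : ∀ {r} → S r ≡ true → Preserves r ComplementClosed
  rules _ (&-inst Γ A B) (c₁ ∷ c₂ ∷ []) =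
    closed-∧ Γ [] (solve 3 (λ Γ A B → (Γ ⊕ A) ⊕ (Γ ⊕ B) ⊜ Γ ⊕ Γ ⊕ A ⊕ B) refl Γ [ A ] [ B ])
                  (solve 2 (λ Γ C → C ⊕ Γ ⊕ ∅ ⊜ Γ ⊕ C) refl Γ [ A ∧ B ]) c₁ c₂
  rules _ (⊗-inst Δ Σ A B) (c₁ ∷ c₂ ∷ []) =
    closed-∧ [] (Δ ++ Σ) (solve 4 (λ Δ Σ A B → (Δ ⊕ A) ⊕ (Σ ⊕ B) ⊜ A ⊕ B ⊕ Δ ⊕ Σ) refl Δ Σ [ A ] [ B ])
                         (solve 3 (λ Δ Σ C → C ⊕ Δ ⊕ Σ ⊜ Δ ⊕ Σ ⊕ C) refl Δ Σ [ A ∧ B ]) c₁ c₂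
  rules _ (∧-inst Γ Δ Σ A B) (c₁ ∷ c₂ ∷ []) =
    closed-∧ Γ (Δ ++ Σ)
      (solve 5 (λ Γ Δ Σ A B → (Γ ⊕ Δ ⊕ A) ⊕ (Γ ⊕ Σ ⊕ B) ⊜ Γ ⊕ Γ ⊕ A ⊕ B ⊕ Δ ⊕ Σ) refl Γ Δ Σ [ A ] [ B ])
      (solve 4 (λ Γ Δ Σ C → C ⊕ Γ ⊕ Δ ⊕ Σ ⊜ Γ ⊕ Δ ⊕ Σ ⊕ C) refl Γ Δ Σ [ A ∧ B ]) c₁ c₂
  rules on (⊕₁-inst _ _ _) _ = ⊥-elim (disabled no-⊕ on)
  rules on (⊕₂-inst _ _ _) _ = ⊥-elim (disabled no-⊕ on)
  rules _ (par-inst Γ A B) (c ∷ []) =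
    closed-resp (≈ₗ-↭ (↭-++-comm Γ (A ∷ B ∷ [])) ⨾ ≈ₗ-split (A ∨ B) Γ refl ⨾ ≈ₗ-↭ (↭-sym (to-front Γ (A ∨ B)))) c
  rules on (W-inst _ _ _) _ = ⊥-elim (disabled no-W on)
  rules _ (C-inst Γ A) (c ∷ []) =
    closed-resp (≈ₗ-↭ (↭-++-comm Γ (A ∷ A ∷ [])) ⨾ ≈ₗ-dup [ A ] Γ ⨾ ≈ₗ-↭ (↭-sym (to-front Γ A))) c
  present : pos 1 ∈ literalsₛ [ (pos 0 ∨ neg 0) ∨ pos 1 ]
  present = there (there (here refl))
  absent : neg 1 ∉ literalsₛ [ (pos 0 ∨ neg 0) ∨ pos 1 ]
  absent (there (there (here ())))
  absent (there (there (there ())))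

data LiteralOf (x : ℕ) : Formula → Set where
  pos : LiteralOf x (pos x)
  neg : LiteralOf x (neg x)

literal-variable-unique : ∀ {x y A} → LiteralOf x A → LiteralOf y A → x ≡ y
literal-variable-unique pos pos = refl
literal-variable-unique neg neg = refl

data Compound : Formula → Set where
  ∧-compound : ∀ {A B} → Compound (A ∧ B)
  ∨-compound : ∀ {A B} → Compound (A ∨ B)

compound-not-literal : ∀ {x A} → Compound A → ¬ LiteralOf x A
compound-not-literal ∧-compound ()
compound-not-literal ∨-compound ()

data Separated : Formula → Set where
  lit : ∀ {x A} → LiteralOf x A → Separated A
  lit∧lit : ∀ {x y A B} → LiteralOf x A → LiteralOf y B → x ≢ y → Separated (A ∧ B)
  compound∨compound : ∀ {A B} → Separated A → Separated B → Compound A → Compound B → Separated (A ∨ B)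

OneVariable : Sequent → Set
OneVariable Γ = ∃ λ x → All (LiteralOf x) Γ × pos x ∈ Γ × neg x ∈ Γ

one-variable-resp : ∀ {Γ Δ} → Γ ⊆ Δ → Δ ⊆ Γ → OneVariable Γ → OneVariable Δ
one-variable-resp Γ⊆Δ Δ⊆Γ (x , lits , p , n) = x , All-resp-⊇ Δ⊆Γ lits , Γ⊆Δ p , Γ⊆Δ n

literal-at : ∀ Γ {A Δ} → OneVariable (Γ ++ A ∷ Δ) → ∃ λ x → LiteralOf x A
literal-at Γ (x , lits , _) = x , All.head (All.++⁻ʳ Γ lits)

context-literal : ∀ Γ {x A} → pos x ∈ Γ ++ [ A ] → neg x ∈ Γ ++ [ A ] → ∃ λ ℓ → ℓ ∈ Γ × LiteralOf x ℓ
context-literal Γ p n with ∈-++⁻ Γ p | ∈-++⁻ Γ n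
... | inj₁ p∈Γ | _ = _ , p∈Γ , pos
... | inj₂ _ | inj₁ n∈Γ = _ , n∈Γ , neg
... | inj₂ (here refl) | inj₂ (here ())

conjuncts-share-variable : ∀ Γ {x y A B} → LiteralOf x A → LiteralOf y B →
                           OneVariable (Γ ++ [ A ]) → OneVariable (Γ ++ [ B ]) → x ≡ y
conjuncts-share-variable Γ x-A y-B (z , lits₁ , p , n) (w , lits₂ , _) with context-literal Γ p n
... | ℓ , ℓ∈Γ , z-ℓ =
  trans (literal-variable-unique x-A (All.head (All.++⁻ʳ Γ lits₁)))
    (trans (literal-variable-unique z-ℓ (All.lookup (All.++⁻ˡ Γ lits₂) ℓ∈Γ))
      (literal-variable-unique (All.head (All.++⁻ʳ Γ lits₂)) y-B))

incomplete-without-⊗-∧-W : ∀ {S} → S ⊗r ≡ false → S ∧r ≡ false → S Wr ≡ false → ¬ Complete S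
incomplete-without-⊗-∧-W {S} no-⊗ no-∧ no-W =
  incomplete-by Invariant (λ p _ → p , pos ∷ neg ∷ [] , here refl , there (here refl))
    (λ π h separated → one-variable-resp (⊆-reflexive-↭ π) (⊆-reflexive-↭ (↭-sym π))
                         (h (All-resp-↭ (↭-sym π) separated)))
    rules F valid (λ h → not-one-variable (h (separated-F ∷ [])))
  where
  Invariant : Sequent → Set
  Invariant Γ = All Separated Γ → OneVariable Γ
  rules : ∀ {r} → S r ≡ true → Preserves r Invariant
  rules on (⊗-inst _ _ _ _) _ _ = ⊥-elim (disabled no-⊗ on)
  rules on (∧-inst _ _ _ _ _) _ _ = ⊥-elim (disabled no-∧ on)
  rules on (W-inst _ _ _) _ _ = ⊥-elim (disabled no-W on)
  rules _ (&-inst Γ _ _) (h₁ ∷ h₂ ∷ []) separated with All.head (All.++⁻ʳ Γ separated)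
  ... | lit ()
  ... | lit∧lit x-A y-B x≢y = ⊥-elim (x≢y (conjuncts-share-variable Γ x-A y-B
          (h₁ (All.++⁺ (All.++⁻ˡ Γ separated) (lit x-A ∷ []))) (h₂ (All.++⁺ (All.++⁻ˡ Γ separated) (lit y-B ∷ [])))))
  rules _ (⊕₁-inst Γ _ _) (h ∷ []) separated with All.head (All.++⁻ʳ Γ separated)
  ... | compound∨compound s _ c _ =
    ⊥-elim (compound-not-literal c (proj₂ (literal-at Γ (h (All.++⁺ (All.++⁻ˡ Γ separated) (s ∷ []))))))
  rules _ (⊕₂-inst Γ _ _) (h ∷ []) separated with All.head (All.++⁻ʳ Γ separated)
  ... | compound∨compound _ s _ c =
    ⊥-elim (compound-not-literal c (proj₂ (literal-at Γ (h (All.++⁺ (All.++⁻ˡ Γ separated) (s ∷ []))))))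
  rules _ (par-inst Γ _ _) (h ∷ []) separated with All.head (All.++⁻ʳ Γ separated)
  ... | compound∨compound s₁ s₂ c _ =
    ⊥-elim (compound-not-literal c (proj₂ (literal-at Γ (h (All.++⁺ (All.++⁻ˡ Γ separated) (s₁ ∷ s₂ ∷ []))))))
  rules _ (C-inst Γ A) (h ∷ []) separated =
    one-variable-resp (++⁺ʳ-⊆ Γ λ { (here e) → here e ; (there e) → e }) (++⁺ʳ-⊆ Γ (xs⊆xs++ys [ A ] [ A ]))
      (h (All.++⁺ (All.++⁻ˡ Γ separated) (s ∷ s ∷ [])))
    where s = All.head (All.++⁻ʳ Γ separated)
  F : Formula
  F = (pos 0 ∧ pos 1) ∨ ((neg 0 ∧ neg 1) ∨ ((pos 0 ∧ neg 1) ∨ (neg 0 ∧ pos 1)))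
  valid : Valid F
  valid v with v 0 | v 1
  ... | true | true = refl
  ... | true | false = refl
  ... | false | true = refl
  ... | false | false = refl
  not-one-variable : ¬ OneVariable [ F ]
  not-one-variable (_ , () ∷ [] , _)
  separated-F : Separated F
  separated-F = compound∨compound (lit∧lit pos pos λ ())
    (compound∨compound (lit∧lit neg neg λ ())
      (compound∨compound (lit∧lit pos neg λ ()) (lit∧lit neg pos λ ()) ∧-compound ∧-compound)
      ∧-compound ∨-compound)
    ∧-compound ∨-compound

weight : (Formula → ℕ) → Sequent → ℕ
weight f Γ = sum (map f Γ)

weight-++ : ∀ f Γ Δ → weight f (Γ ++ Δ) ≡ weight f Γ + weight f Δ
weight-++ f Γ Δ = trans (cong sum (map-++ f Γ Δ)) (sum-++ (map f Γ) (map f Δ))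

weight-∷ʳ : ∀ f Γ A → weight f (Γ ++ [ A ]) ≡ weight f Γ + f A
weight-∷ʳ f Γ A = trans (weight-++ f Γ [ A ]) (cong (weight f Γ +_) (+-identityʳ (f A)))

weight-↭ : ∀ f {Γ Δ} → Γ ↭ Δ → weight f Γ ≡ weight f Δ
weight-↭ f π = sum-↭ (↭-map⁺ f π)

weight-++-≤ : ∀ f Γ Δ → weight f Γ ≤ weight f (Γ ++ Δ)
weight-++-≤ f Γ Δ = subst (weight f Γ ≤_) (sym (weight-++ f Γ Δ)) (m≤m+n _ _)

weight-++-cong : ∀ f Γ {Δ Δ′} → weight f Δ ≡ weight f Δ′ → weight f (Γ ++ Δ) ≡ weight f (Γ ++ Δ′)
weight-++-cong f Γ eq = trans (weight-++ f Γ _) (trans (cong (weight f Γ +_) eq) (sym (weight-++ f Γ _)))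

data PartOfF : Formula → Set where
  P : PartOfF (pos 0)
  P̄ : PartOfF (neg 0)
  P∧P : PartOfF (pos 0 ∧ pos 0)
  F : PartOfF ((pos 0 ∧ pos 0) ∨ neg 0)

countP countP̄ : Formula → ℕ
countP (pos zero) = 1
countP _ = 0
countP̄ (neg zero) = 1
countP̄ ((pos zero ∧ pos zero) ∨ neg zero) = 1
countP̄ _ = 0

-- Each ⊗ on P ∧ P consumes a P̄ from both premises, and without contraction there is only one.
record Supplied (Γ : Sequent) : Set where
  constructor supplied
  field
    one : 1 ≤ weight countP̄ Γ
    two : 2 ≤ weight countP̄ Γ + weight countP Γ

supplied-mono : ∀ {Γ Δ} → weight countP̄ Γ ≤ weight countP̄ Δ → weight countP Γ ≤ weight countP Δ →
                Supplied Γ → Supplied Δ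
supplied-mono P̄≤ P≤ (supplied one two) = supplied (≤-trans one P̄≤) (≤-trans two (+-mono-≤ P̄≤ P≤))

supplied-≡ : ∀ {Γ Δ} → weight countP̄ Γ ≡ weight countP̄ Δ → weight countP Γ ≡ weight countP Δ →
             Supplied Γ → Supplied Δ
supplied-≡ P̄≡ P≡ = supplied-mono (≤-reflexive P̄≡) (≤-reflexive P≡)

supplied-by-two : ∀ Γ → 2 ≤ weight countP̄ Γ → Supplied Γ
supplied-by-two Γ two = supplied (≤-trans (s≤s z≤n) two) (≤-trans two (m≤m+n _ _))

P̄-in-context : ∀ Γ {A} → countP̄ A ≡ 0 → Supplied (Γ ++ [ A ]) → 1 ≤ weight countP̄ Γ
P̄-in-context Γ {A} none (supplied one _) =
  subst (1 ≤_) (trans (weight-∷ʳ countP̄ Γ A) (trans (cong (weight countP̄ Γ +_) none) (+-identityʳ _))) one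

incomplete-without-&-∧-C : ∀ {S} → S &r ≡ false → S ∧r ≡ false → S Cr ≡ false → ¬ Complete S
incomplete-without-&-∧-C {S} no-& no-∧ no-C =
  incomplete-by Invariant axiom-supplied
    (λ π h parts → supplied-≡ (weight-↭ countP̄ π) (weight-↭ countP π) (h (All-resp-↭ (↭-sym π) parts)))
    rules ((pos 0 ∧ pos 0) ∨ neg 0) valid (λ h → unsupplied (h (F ∷ [])))
  where
  Invariant : Sequent → Set
  Invariant Γ = All PartOfF Γ → Supplied Γ
  axiom-supplied : ∀ p → Invariant (pos p ∷ neg p ∷ [])
  axiom-supplied _ (P ∷ _) = supplied (s≤s z≤n) (s≤s (s≤s z≤n))
  rules : ∀ {r} → S r ≡ true → Preserves r Invariant
  rules on (&-inst _ _ _) _ _ = ⊥-elim (disabled no-& on)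
  rules on (∧-inst _ _ _ _ _) _ _ = ⊥-elim (disabled no-∧ on)
  rules on (C-inst _ _) _ _ = ⊥-elim (disabled no-C on)
  rules _ (⊗-inst Δ Σ _ _) (h₁ ∷ h₂ ∷ []) parts with All.head (All.++⁻ʳ Σ (All.++⁻ʳ Δ parts))
  ... | P∧P = supplied-by-two (Δ ++ Σ ++ [ pos 0 ∧ pos 0 ]) (begin
    2                                                   ≤⟨ +-mono-≤ P̄-in-Δ P̄-in-Σ ⟩
    weight countP̄ Δ + weight countP̄ Σ                   ≤⟨ +-monoʳ-≤ (weight countP̄ Δ) (weight-++-≤ countP̄ Σ _) ⟩
    weight countP̄ Δ + weight countP̄ (Σ ++ [ _ ])        ≡⟨ sym (weight-++ countP̄ Δ _) ⟩
    weight countP̄ (Δ ++ Σ ++ [ pos 0 ∧ pos 0 ])          ∎)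
    where
    open ≤-Reasoning
    P̄-in-Δ = P̄-in-context Δ refl (h₁ (All.++⁺ (All.++⁻ˡ Δ parts) (P ∷ [])))
    P̄-in-Σ = P̄-in-context Σ refl (h₂ (All.++⁺ (All.++⁻ˡ Σ (All.++⁻ʳ Δ parts)) (P ∷ [])))
  rules _ (⊕₁-inst Γ _ _) (h ∷ []) parts with All.head (All.++⁻ʳ Γ parts)
  ... | F = supplied-by-two (Γ ++ [ _ ]) (subst (2 ≤_) (sym (weight-∷ʳ countP̄ Γ _))
              (+-monoˡ-≤ 1 (P̄-in-context Γ refl (h (All.++⁺ (All.++⁻ˡ Γ parts) (P∧P ∷ []))))))
  rules _ (⊕₂-inst Γ _ _) (h ∷ []) parts with All.head (All.++⁻ʳ Γ parts)
  ... | F = supplied-≡ (weight-++-cong countP̄ Γ refl) (weight-++-cong countP Γ refl)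
              (h (All.++⁺ (All.++⁻ˡ Γ parts) (P̄ ∷ [])))
  rules _ (par-inst Γ _ _) (h ∷ []) parts with All.head (All.++⁻ʳ Γ parts)
  ... | F = supplied-≡ (weight-++-cong countP̄ Γ refl) (weight-++-cong countP Γ refl)
              (h (All.++⁺ (All.++⁻ˡ Γ parts) (P∧P ∷ P̄ ∷ [])))
  rules _ (W-inst C Γ _) (h ∷ []) (part ∷ parts) =
    supplied-mono (+-monoʳ-≤ (countP̄ C) (weight-++-≤ countP̄ Γ _)) (+-monoʳ-≤ (countP C) (weight-++-≤ countP Γ _))
      (h (part ∷ All.++⁻ˡ Γ parts))
  valid : Valid ((pos 0 ∧ pos 0) ∨ neg 0)
  valid v with v 0
  ... | true = refl
  ... | false = refl
  unsupplied : ¬ Supplied [ (pos 0 ∧ pos 0) ∨ neg 0 ]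
  unsupplied (supplied _ (s≤s ()))

infix 4 _⊑_
data _⊑_ (Γ Λ : Sequent) : Set where
  sub : ∀ R → Γ ++ R ↭ Λ → Γ ⊑ Λ

⊑-resp-↭ : ∀ {Γ Δ Λ} → Γ ↭ Δ → Δ ⊑ Λ → Γ ⊑ Λ
⊑-resp-↭ π (sub R ρ) = sub R (↭-trans (++⁺ʳ R π) ρ)

⊑-++ˡ : ∀ Γ {Δ Λ} → Γ ++ Δ ⊑ Λ → Γ ⊑ Λ
⊑-++ˡ Γ {Δ} (sub R ρ) = sub (Δ ++ R) (↭-trans (↭-reflexive (sym (++-assoc Γ Δ R))) ρ)

⊑-++ʳ : ∀ Γ {Δ Λ} → Γ ++ Δ ⊑ Λ → Δ ⊑ Λ
⊑-++ʳ Γ {Δ} (sub R ρ) = sub (Γ ++ R) (↭-trans (shifts Δ Γ) (↭-trans (↭-reflexive (sym (++-assoc Γ Δ R))) ρ))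

⊑-∷ʳ : ∀ {Γ Λ} A → Γ ⊑ Λ → Γ ++ [ A ] ⊑ Λ ++ [ A ]
⊑-∷ʳ {Γ} A (sub R ρ) = sub R (↭-trans (solve 3 (λ Γ A R → (Γ ⊕ A) ⊕ R ⊜ (Γ ⊕ R) ⊕ A) refl Γ [ A ] R) (++⁺ʳ [ A ] ρ))
  where open ↭-Solver using (solve; _⊕_; _⊜_)

⊑-extend : ∀ {Γ Λ} Δ → Γ ⊑ Λ → Γ ⊑ Λ ++ Δ
⊑-extend {Γ} Δ (sub R ρ) = sub (R ++ Δ) (↭-trans (↭-reflexive (sym (++-assoc Γ R Δ))) (++⁺ʳ Δ ρ))

∈-⊑ : ∀ {A Γ Λ} → A ∈ Γ → Γ ⊑ Λ → A ∈ Λ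
∈-⊑ A∈Γ (sub R ρ) = ∈-resp-↭ ρ (∈-++⁺ˡ A∈Γ)

weight-⊑ : ∀ f {Γ Λ} → Γ ⊑ Λ → weight f Γ ≤ weight f Λ
weight-⊑ f {Γ} (sub R ρ) = subst (weight f Γ ≤_) (weight-↭ f ρ) (weight-++-≤ f Γ R)

count⁺ count⁻ : ℕ → Formula → ℕ
count⁺ x (pos y) = if x ≡ᵇ y then 1 else 0
count⁺ x (neg y) = 0
count⁺ x (A ∧ B) = count⁺ x A + count⁺ x B
count⁺ x (A ∨ B) = count⁺ x A + count⁺ x B
count⁻ x (pos y) = 0
count⁻ x (neg y) = if x ≡ᵇ y then 1 else 0
count⁻ x (A ∧ B) = count⁻ x A + count⁻ x B
count⁻ x (A ∨ B) = count⁻ x A + count⁻ x B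

record Balanced (Γ : Sequent) : Set where
  constructor balanced
  field counts : ∀ x → weight (count⁺ x) Γ ≡ weight (count⁻ x) Γ

balanced-↭ : ∀ {Γ Δ} → Γ ↭ Δ → Balanced Γ → Balanced Δ
balanced-↭ π (balanced counts) =
  balanced λ x → trans (sym (weight-↭ (count⁺ x) π)) (trans (counts x) (weight-↭ (count⁻ x) π))

balanced-++ : ∀ {Γ Δ} → Balanced Γ → Balanced Δ → Balanced (Γ ++ Δ)
balanced-++ {Γ} {Δ} (balanced countsΓ) (balanced countsΔ) = balanced λ x →
  trans (weight-++ (count⁺ x) Γ Δ) (trans (cong₂ _+_ (countsΓ x) (countsΔ x)) (sym (weight-++ (count⁻ x) Γ Δ)))

balanced-merge : ∀ {A B} C Γ → (∀ x → count⁺ x C ≡ count⁺ x A + count⁺ x B) →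
                 (∀ x → count⁻ x C ≡ count⁻ x A + count⁻ x B) → Balanced (A ∷ B ∷ Γ) → Balanced (C ∷ Γ)
balanced-merge {A} {B} C Γ add⁺ add⁻ (balanced counts) = balanced λ x →
  trans (merge (count⁺ x) (add⁺ x)) (trans (counts x) (sym (merge (count⁻ x) (add⁻ x))))
  where
  merge : ∀ f → f C ≡ f A + f B → weight f (C ∷ Γ) ≡ weight f (A ∷ B ∷ Γ)
  merge f add = trans (cong (_+ weight f Γ) add) (+-assoc (f A) (f B) (weight f Γ))

&-balanced : ∀ Γ {A B} → Balanced (Γ ++ [ A ]) → Balanced (Γ ++ [ B ]) →
             ∀ x → count⁺ x A + count⁻ x B ≡ count⁺ x B + count⁻ x A
&-balanced Γ {A} {B} (balanced counts₁) (balanced counts₂) x = +-cancelˡ-≡ (p + n) _ _ (begin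
  (p + n) + (a⁺ + b⁻) ≡⟨ solve 4 (λ p n a b → (p :+ n) :+ (a :+ b) := (p :+ a) :+ (n :+ b)) refl p n a⁺ b⁻ ⟩
  (p + a⁺) + (n + b⁻) ≡⟨ cong₂ _+_ (side counts₁) (sym (side counts₂)) ⟩
  (n + a⁻) + (p + b⁺) ≡⟨ solve 4 (λ p n a b → (n :+ a) :+ (p :+ b) := (p :+ n) :+ (b :+ a)) refl p n a⁻ b⁺ ⟩
  (p + n) + (b⁺ + a⁻) ∎)
  where
  open ≡-Reasoning
  open +-*-Solver using (solve; _:+_; _:=_)
  p = weight (count⁺ x) Γ
  n = weight (count⁻ x) Γ
  a⁺ = count⁺ x A
  a⁻ = count⁻ x A
  b⁺ = count⁺ x B
  b⁻ = count⁻ x B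
  side : ∀ {C} → (∀ x → weight (count⁺ x) (Γ ++ [ C ]) ≡ weight (count⁻ x) (Γ ++ [ C ])) →
         p + count⁺ x C ≡ n + count⁻ x C
  side {C} counts = trans (sym (weight-∷ʳ (count⁺ x) Γ C)) (trans (counts x) (weight-∷ʳ (count⁻ x) Γ C))

overweight : ∀ f g {Γ Λ A} → Γ ⊑ Λ → weight f Λ + f A < g A → weight f (Γ ++ [ A ]) ≢ weight g (Γ ++ [ A ])
overweight f g {Γ} {Λ} {A} Γ⊑Λ lt eq = <-irrefl eq (begin-strict
  weight f (Γ ++ [ A ]) ≡⟨ weight-∷ʳ f Γ A ⟩
  weight f Γ + f A      ≤⟨ +-monoˡ-≤ (f A) (weight-⊑ f Γ⊑Λ) ⟩
  weight f Λ + f A      <⟨ lt ⟩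
  g A                   ≤⟨ m≤n+m (g A) (weight g Γ) ⟩
  weight g Γ + g A      ≡⟨ weight-∷ʳ g Γ A ⟨
  weight g (Γ ++ [ A ]) ∎)
  where open ≤-Reasoning

-- ⊗ and par preserve the literal counts. Among the sequents reachable from f₀ without structural
-- rules, & and ⊕ only have unbalanced premises, and f₀ itself is unbalanced: it has two P₂ but one P̄₂.
module MixedConjunction where

  a₀ a₁ f₀ f₁ f₂ f₃ : Formula
  a₀ = pos 0 ∧ pos 2
  a₁ = pos 1 ∧ pos 2
  f₃ = a₀ ∧ a₁
  f₂ = neg 1 ∨ f₃
  f₁ = neg 0 ∨ f₂
  f₀ = neg 2 ∨ f₁

  sides : Sequent
  sides = neg 2 ∷ neg 0 ∷ neg 1 ∷ []

  -- Node A Λ: A is a subformula of f₀ and Λ lists the side literals split off by the disjunctions above it.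
  data Node : Formula → Sequent → Set where
    root : Node f₀ []
    n₂ : Node (neg 2) []
    d₁ : Node f₁ [ neg 2 ]
    n₀ : Node (neg 0) [ neg 2 ]
    d₂ : Node f₂ (neg 2 ∷ neg 0 ∷ [])
    n₁ : Node (neg 1) (neg 2 ∷ neg 0 ∷ [])
    d₃ : Node f₃ sides
    c₀ : Node a₀ sides
    c₁ : Node a₁ sides
    p₀ : Node (pos 0) sides
    p₁ : Node (pos 1) sides
    p₂ : Node (pos 2) sides

  conjuncts : ∀ {A B Λ} → Node (A ∧ B) Λ → Node A Λ × Node B Λ
  conjuncts d₃ = c₀ , c₁
  conjuncts c₀ = p₀ , p₂
  conjuncts c₁ = p₁ , p₂

  disjuncts : ∀ {A B Λ} → Node (A ∨ B) Λ → Node A Λ × Node B (Λ ++ [ A ])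
  disjuncts root = n₂ , d₁
  disjuncts d₁ = n₀ , d₂
  disjuncts d₂ = n₁ , d₃

  data Negative : Formula → Set where
    neg : ∀ {p} → Negative (neg p)

  context-negative : ∀ {A Λ} → Node A Λ → All Negative Λ
  context-negative root = []
  context-negative n₂ = []
  context-negative d₁ = neg ∷ []
  context-negative n₀ = neg ∷ []
  context-negative d₂ = neg ∷ neg ∷ []
  context-negative n₁ = neg ∷ neg ∷ []
  context-negative d₃ = neg ∷ neg ∷ neg ∷ []
  context-negative c₀ = neg ∷ neg ∷ neg ∷ []
  context-negative c₁ = neg ∷ neg ∷ neg ∷ []
  context-negative p₀ = neg ∷ neg ∷ neg ∷ []
  context-negative p₁ = neg ∷ neg ∷ neg ∷ []
  context-negative p₂ = neg ∷ neg ∷ neg ∷ []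

  data Reachable (Γ : Sequent) : Set where
    reachable : ∀ {A Λ Ν} → Node A Λ → Ν ⊑ Λ → Γ ↭ A ∷ Ν → Reachable Γ

  reach : ∀ {A Γ Λ} → Node A Λ → Γ ⊑ Λ → Reachable (Γ ++ [ A ])
  reach {A} {Γ} node Γ⊑Λ = reachable node Γ⊑Λ (to-front Γ A)

  reachable-↭ : ∀ {Γ Δ} → Γ ↭ Δ → Reachable Γ → Reachable Δ
  reachable-↭ π (reachable node Ν⊑Λ ρ) = reachable node Ν⊑Λ (↭-trans (↭-sym π) ρ)

  reachable-active : ∀ {Γ C} → ¬ Negative C → Reachable (Γ ++ [ C ]) → ∃ λ Λ → Node C Λ × Γ ⊑ Λ
  reachable-active {Γ} {C} ¬negative (reachable {Λ = Λ} node Ν⊑Λ π) with ∈-resp-↭ π (∈-++⁺ʳ Γ (here refl))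
  ... | here refl = Λ , node , ⊑-resp-↭ (drop-∷ (↭-trans (↭-sym (to-front Γ C)) π)) Ν⊑Λ
  ... | there C∈Ν = ⊥-elim (¬negative (All.lookup (context-negative node) (∈-⊑ C∈Ν Ν⊑Λ)))

  conjuncts-unbalanced : ∀ {A B Λ} → Node (A ∧ B) Λ → ∃ λ x → count⁺ x A + count⁻ x B ≢ count⁺ x B + count⁻ x A
  conjuncts-unbalanced d₃ = 0 , λ ()
  conjuncts-unbalanced c₀ = 0 , λ ()
  conjuncts-unbalanced c₁ = 1 , λ ()

  left-unbalanced : ∀ {A B Γ Λ} → Node (A ∨ B) Λ → Γ ⊑ Λ → ¬ Balanced (Γ ++ [ A ])
  left-unbalanced root Γ⊑Λ (balanced counts) = overweight (count⁺ 2) (count⁻ 2) Γ⊑Λ (s≤s z≤n) (counts 2)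
  left-unbalanced d₁ Γ⊑Λ (balanced counts) = overweight (count⁺ 0) (count⁻ 0) Γ⊑Λ (s≤s z≤n) (counts 0)
  left-unbalanced d₂ Γ⊑Λ (balanced counts) = overweight (count⁺ 1) (count⁻ 1) Γ⊑Λ (s≤s z≤n) (counts 1)

  right-unbalanced : ∀ {A B Γ Λ} → Node (A ∨ B) Λ → Γ ⊑ Λ → ¬ Balanced (Γ ++ [ B ])
  right-unbalanced root Γ⊑Λ (balanced counts) =
    overweight (count⁻ 2) (count⁺ 2) Γ⊑Λ (s≤s z≤n) (sym (counts 2))
  right-unbalanced d₁ Γ⊑Λ (balanced counts) =
    overweight (count⁻ 2) (count⁺ 2) Γ⊑Λ (s≤s (s≤s z≤n)) (sym (counts 2))
  right-unbalanced d₂ Γ⊑Λ (balanced counts) =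
    overweight (count⁻ 2) (count⁺ 2) Γ⊑Λ (s≤s (s≤s z≤n)) (sym (counts 2))

  valid : Valid f₀
  valid v with v 0 | v 1 | v 2
  ... | true | true | true = refl
  ... | true | true | false = refl
  ... | true | false | true = refl
  ... | true | false | false = refl
  ... | false | true | true = refl
  ... | false | true | false = refl
  ... | false | false | true = refl
  ... | false | false | false = refl

incomplete-without-∧-C-W : ∀ {S} → S ∧r ≡ false → S Cr ≡ false → S Wr ≡ false → ¬ Complete S
incomplete-without-∧-C-W {S} no-∧ no-C no-W =
  incomplete-by (λ Γ → Reachable Γ → Balanced Γ) (λ p _ → axiom-balanced p)
    (λ π h r → balanced-↭ π (h (reachable-↭ (↭-sym π) r))) rules f₀ valid
    (λ h → unbalanced (h (reach root (sub [] refl))))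
  where
  open MixedConjunction
  open ↭-Solver using (solve; _⊕_; _⊜_)
  axiom-balanced : ∀ p → Balanced (pos p ∷ neg p ∷ [])
  axiom-balanced p = balanced λ x → lemma (x ≡ᵇ p)
    where
    lemma : ∀ b → (if b then 1 else 0) + (0 + 0) ≡ 0 + ((if b then 1 else 0) + 0)
    lemma true = refl
    lemma false = refl
  unbalanced : ¬ Balanced [ f₀ ]
  unbalanced (balanced counts) with counts 2
  ... | ()
  rules : ∀ {r} → S r ≡ true → Preserves r (λ Γ → Reachable Γ → Balanced Γ)
  rules on (∧-inst _ _ _ _ _) _ _ = ⊥-elim (disabled no-∧ on)
  rules on (C-inst _ _) _ _ = ⊥-elim (disabled no-C on)
  rules on (W-inst _ _ _) _ _ = ⊥-elim (disabled no-W on)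
  rules _ (&-inst Γ A B) (h₁ ∷ h₂ ∷ []) r
    with Λ , node , Γ⊑Λ ← reachable-active (λ ()) r
    with x , unequal ← conjuncts-unbalanced node =
    ⊥-elim (unequal (&-balanced Γ (h₁ (reach (proj₁ (conjuncts node)) Γ⊑Λ))
                                  (h₂ (reach (proj₂ (conjuncts node)) Γ⊑Λ)) x))
  rules _ (⊗-inst Δ Σ A B) (h₁ ∷ h₂ ∷ []) r
    with Λ , node , ΔΣ⊑Λ ← reachable-active {Δ ++ Σ} (λ ()) (reachable-↭ (↭-reflexive (sym (++-assoc Δ Σ _))) r) =
    balanced-↭ (solve 3 (λ Δ Σ C → C ⊕ Δ ⊕ Σ ⊜ Δ ⊕ Σ ⊕ C) refl Δ Σ [ A ∧ B ])
      (balanced-merge (A ∧ B) (Δ ++ Σ) (λ _ → refl) (λ _ → refl)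
        (balanced-↭ (solve 4 (λ Δ Σ A B → (Δ ⊕ A) ⊕ (Σ ⊕ B) ⊜ A ⊕ B ⊕ Δ ⊕ Σ) refl Δ Σ [ A ] [ B ])
          (balanced-++ (h₁ (reach (proj₁ (conjuncts node)) (⊑-++ˡ Δ ΔΣ⊑Λ)))
                       (h₂ (reach (proj₂ (conjuncts node)) (⊑-++ʳ Δ ΔΣ⊑Λ))))))
  rules _ (⊕₁-inst Γ A B) (h ∷ []) r
    with Λ , node , Γ⊑Λ ← reachable-active (λ ()) r =
    ⊥-elim (left-unbalanced node Γ⊑Λ (h (reach (proj₁ (disjuncts node)) Γ⊑Λ)))
  rules _ (⊕₂-inst Γ A B) (h ∷ []) r
    with Λ , node , Γ⊑Λ ← reachable-active (λ ()) r =
    ⊥-elim (right-unbalanced node Γ⊑Λ (h (reach (proj₂ (disjuncts node)) (⊑-extend [ A ] Γ⊑Λ))))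
  rules _ (par-inst Γ A B) (h ∷ []) r
    with Λ , node , Γ⊑Λ ← reachable-active (λ ()) r =
    balanced-↭ (↭-sym (to-front Γ (A ∨ B)))
      (balanced-merge (A ∨ B) Γ (λ _ → refl) (λ _ → refl)
        (balanced-↭ (↭-++-comm Γ (A ∷ B ∷ []))
          (h (reachable-↭ (↭-reflexive (++-assoc Γ [ A ] [ B ])) (reach (proj₂ (disjuncts node)) (⊑-∷ʳ A Γ⊑Λ))))))

-- Classification

module _ {S : System} (complete : Complete S) where

  contains-GS1p : S Cr ≡ true → S Wr ≡ true → Contains S GS1p
  contains-GS1p c w &r _ with S &r in k | S ∧r in m | S ⊗r in a
  ... | true | _ | _ = rule-derivable k
  ... | false | true | _ = &-from-∧ m
  ... | false | false | true = &-from-⊗-C a c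
  ... | false | false | false = ⊥-elim (incomplete-without-conjunction k m a complete)
  contains-GS1p c w ⊕r _ with S ⊕r in o
  ... | true = rule-derivable o
  ... | false = ⊕-from-par-W (¬-not λ no-par → incomplete-without-disjunction o no-par complete) w
  contains-GS1p c w Cr _ = rule-derivable c
  contains-GS1p c w Wr _ = rule-derivable w

  contains-Pp : S Cr ≡ true → S Wr ≡ false → Contains S Pp
  contains-Pp c w ⊗r _ with S ⊗r in a | S ∧r in m
  ... | true | _ = rule-derivable a
  ... | false | true = ⊗-from-∧ m
  ... | false | false = ⊥-elim (incomplete-without-⊗-∧-W a m w complete)
  contains-Pp c w ⊕r _ = rule-derivable (¬-not λ no-⊕ → incomplete-without-⊕-and-W no-⊕ w complete)
  contains-Pp c w Cr _ = rule-derivable c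

  contains-Np : S Cr ≡ false → S Wr ≡ true → Contains S Np
  contains-Np c w &r _ with S &r in k | S ∧r in m
  ... | true | _ = rule-derivable k
  ... | false | true = &-from-∧ m
  ... | false | false = ⊥-elim (incomplete-without-&-∧-C k m c complete)
  contains-Np c w parr _ = rule-derivable (¬-not λ no-par → incomplete-without-par-and-C no-par c complete)
  contains-Np c w Wr _ = rule-derivable w

  contains-Mp : S Cr ≡ false → S Wr ≡ false → Contains S Mp
  contains-Mp c w ∧r _ = rule-derivable (¬-not λ no-∧ → incomplete-without-∧-C-W no-∧ c w complete)
  contains-Mp c w ⊕r _ = rule-derivable (¬-not λ no-⊕ → incomplete-without-⊕-and-W no-⊕ w complete)
  contains-Mp c w parr _ = rule-derivable (¬-not λ no-par → incomplete-without-par-and-C no-par c complete)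

  classify : Equivalent S GS1p ⊎ Equivalent S Pp ⊎ Equivalent S Np ⊎ Equivalent S Mp
  classify with S Cr in c | S Wr in w
  ... | true | true = inj₁ (contains-GS1p c w , GS1p-contains)
  ... | true | false = inj₂ (inj₁ (contains-Pp c w , Pp-contains w))
  ... | false | true = inj₂ (inj₂ (inj₁ (contains-Np c w , Np-contains c)))
  ... | false | false = inj₂ (inj₂ (inj₂ (contains-Mp c w , Mp-contains c w)))

theorem23 : (Complete GS1p × Complete Pp × Complete Np × Complete Mp)
    × (∀ (S : System) → Complete S →
         Equivalent S GS1p ⊎ Equivalent S Pp ⊎ Equivalent S Np ⊎ Equivalent S Mp)
theorem23 =
  ( complete-mono GS1p-contains Mp-complete
  , complete-mono (Pp-contains refl) Mp-complete
  , complete-mono (Np-contains refl) Mp-complete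
  , Mp-complete )
  , λ S → classify
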